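{- Let $G$ be a finite simple graph of order $n \ge 2$ with no isolated vertex. Then $\gamma(M(G)) = \rho(G)$.
   Context: For a finite simple graph $G$, the middle graph $M(G)$ is the graph with vertex set $V(G)\cup E(G)$ in which two elements $x,y$ are adjacent if and only if either (1) $x,y\in E(G)$ and the edges $x,y$ share a common endpoint in $G$, or (2) $x\in V(G)$, $y\in E(G)$ and $x$ is an endpoint of $y$ (or vice versa). A dominating set of a graph $H$ is a set $S\subseteq V(H)$ such that every vertex of $H$ is in $S$ or adjacent to a vertex of $S$; the domination number $\gamma(H)$ is the minimum cardinality of a dominating set of $H$. An edge cover of $G$ is a set $S\subseteq E(G)$ such that every vertex of $G$ is an endpoint of at least one edge of $S$; the edge cover number $\rho(G)$ is the minimum cardinality of an edge cover of $G$. -}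

module Defs where

open import Data.Nat using (ℕ; _≤_)
open import Data.Fin using (Fin) renaming (_<_ to _<ᶠ_)
open import Data.Bool using (Bool; T)
open import Data.Sum using (_⊎_)
open import Data.Product using (Σ; _×_; ∃-syntax)
open import Data.List using (List; length)
open import Data.List.Membership.Propositional using (_∈_)
open import Data.List.Relation.Unary.Unique.Propositional using (Unique)
open import Relation.Nullary using (¬_)
open import Relation.Binary.PropositionalEquality using (_≡_; _≢_)

record SimpleGraph (n : ℕ) : Set where
  field
    adj       : Fin n → Fin n → Bool
    symmetric : ∀ i j → adj i j ≡ adj j i
    loopless  : ∀ i → ¬ T (adj i i)
open SimpleGraph public

-- An edge {u,v} of G, represented canonically with u < v.
record Edge {n : ℕ} (G : SimpleGraph n) : Set where
  constructor edge
  field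
    u   : Fin n
    v   : Fin n
    u<v : u <ᶠ v
    uv  : T (adj G u v)
open Edge public

_isEndOf_ : ∀ {n} {G : SimpleGraph n} → Fin n → Edge G → Set
x isEndOf e = (x ≡ u e) ⊎ (x ≡ v e)

IsolatedVertex : ∀ {n} → SimpleGraph n → Fin n → Set
IsolatedVertex G x = ∀ y → ¬ T (adj G x y)

NoIsolatedVertex : ∀ {n} → SimpleGraph n → Set
NoIsolatedVertex G = ∀ x → ¬ IsolatedVertex G x

MVertex : ∀ {n} → SimpleGraph n → Set
MVertex {n} G = Fin n ⊎ Edge G

data MAdj {n : ℕ} {G : SimpleGraph n} : MVertex G → MVertex G → Set where
  edge-edge : ∀ (e f : Edge G) → e ≢ f → (x : Fin n) → x isEndOf e → x isEndOf f →
              MAdj (Data.Sum.inj₂ e) (Data.Sum.inj₂ f)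
  vert-edge : ∀ (x : Fin n) (e : Edge G) → x isEndOf e →
              MAdj (Data.Sum.inj₁ x) (Data.Sum.inj₂ e)
  edge-vert : ∀ (e : Edge G) (x : Fin n) → x isEndOf e →
              MAdj (Data.Sum.inj₂ e) (Data.Sum.inj₁ x)

IsDominatingSetM : ∀ {n} (G : SimpleGraph n) → List (MVertex G) → Set
IsDominatingSetM G S =
  Unique S × (∀ (x : MVertex G) → (x ∈ S) ⊎ (∃[ y ] (y ∈ S × MAdj x y)))

IsDominationNumberM : ∀ {n} (G : SimpleGraph n) → ℕ → Set
IsDominationNumberM G k =
  (∃[ S ] (IsDominatingSetM G S × length S ≡ k)) ×
  (∀ S → IsDominatingSetM G S → k ≤ length S)

IsEdgeCover : ∀ {n} (G : SimpleGraph n) → List (Edge G) → Set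
IsEdgeCover {n} G S = Unique S × (∀ (x : Fin n) → ∃[ e ] (e ∈ S × x isEndOf e))

IsEdgeCoverNumber : ∀ {n} (G : SimpleGraph n) → ℕ → Set
IsEdgeCoverNumber G k =
  (∃[ S ] (IsEdgeCover G S × length S ≡ k)) ×
  (∀ S → IsEdgeCover G S → k ≤ length S)

-- The two inequalities are witnessed by translations between edge covers of G
-- and dominating sets of the middle graph M(G):
--   * an edge cover C, viewed as a set of edge-vertices of M(G), dominates M(G):
--     a vertex x lies on an edge of C, and an edge e ∉ C meets the edge of C
--     covering its endpoint u e;
--   * a dominating set D yields a covering list of edges of length |D| by
--     replacing each vertex x ∈ D by some edge at x (here we need that x is not
--     isolated); a vertex x ∉ D is dominated by an edge containing it.
-- Both numbers are minima, so we also need a minimum edge cover.  We obtain it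
-- from finiteness: every covering list of edges can be trimmed to a duplicate-
-- free edge cover which is a sublist of a fixed enumeration of E(G) and is no
-- longer, so it suffices to minimise the length over the finitely many
-- sublists of that enumeration which are edge covers (the full enumeration is
-- one of them).
module Submission where

open import Defs
open import Data.Nat using (ℕ; _≤_; suc; z≤n; s≤s)
open import Data.Nat.Properties using (≤-trans)
open import Data.Product using (Σ; ∃-syntax; _×_; _,_; proj₁; proj₂)
open import Data.Sum using (_⊎_; inj₁; inj₂)
open import Data.Fin using (Fin)
import Data.Fin.Properties as Fin
open import Data.Bool using (T)
open import Data.Bool.Properties using (T?; T-irrelevant)
open import Data.List using (List; []; _∷_; _++_; length; map; filter; concatMap; allFin; deduplicate)
open import Data.List.Properties using (length-map)
open import Data.List.Relation.Unary.Any using (here; there)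
import Data.List.Relation.Unary.Any as Any
import Data.List.Relation.Unary.All as All
open import Data.List.Relation.Unary.All.Properties using (all-filter)
open import Data.List.Membership.Propositional using (_∈_; find; lose)
open import Data.List.Membership.Propositional.Properties
  using (∈-map⁺; ∈-++⁺ˡ; ∈-++⁺ʳ; ∈-concatMap⁺; ∈-allFin; ∈-filter⁺; ∈-filter⁻; ∈-deduplicate⁺)
open import Data.List.Membership.DecPropositional as DecMembership using ()
open import Data.List.Relation.Unary.Unique.Propositional using (Unique)
open import Data.List.Relation.Unary.AllPairs using (_∷_)
import Data.List.Relation.Unary.Unique.Propositional.Properties as Unique
open import Data.List.Relation.Unary.Unique.DecPropositional using (unique?)
open import Data.List.Relation.Unary.Unique.DecPropositional.Properties using (deduplicate-!)
open import Data.List.Extrema.Nat using (argmin; argmin-all; f[argmin]≤f[xs])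
open import Relation.Nullary using (Dec; yes; no)
open import Relation.Nullary.Decidable using (_×-dec_; _⊎-dec_; map′)
open import Level using (0ℓ)
open import Relation.Unary using (Pred; Decidable)
open import Relation.Binary using (DecidableEquality; tri<; tri≈; tri>)
open import Relation.Binary.PropositionalEquality using (_≡_; _≢_; refl; sym; cong; cong₂; subst)
open import Data.Empty using (⊥-elim)

module _ {A : Set} where

  remove : ∀ {x} (ys : List A) → x ∈ ys → List A
  remove (_ ∷ ys) (here _)  = ys
  remove (y ∷ ys) (there p) = y ∷ remove ys p

  length-remove : ∀ {x} ys (p : x ∈ ys) → length ys ≡ suc (length (remove ys p))
  length-remove (_ ∷ _)  (here _)  = refl
  length-remove (_ ∷ ys) (there p) = cong suc (length-remove ys p)

  ∈-remove : ∀ {x z} ys (p : x ∈ ys) → z ∈ ys → z ≢ x → z ∈ remove ys p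
  ∈-remove (_ ∷ _)  (here refl) (here refl) z≢x = ⊥-elim (z≢x refl)
  ∈-remove (_ ∷ _)  (here refl) (there q)   _   = q
  ∈-remove (_ ∷ _)  (there p)   (here refl) _   = here refl
  ∈-remove (_ ∷ ys) (there p)   (there q)   z≢x = there (∈-remove ys p q z≢x)

  unique-⊆⇒length≤ : ∀ xs ys → Unique xs → (∀ {z} → z ∈ xs → z ∈ ys) →
                     length xs ≤ length ys
  unique-⊆⇒length≤ []       _  _            _   = z≤n
  unique-⊆⇒length≤ (x ∷ xs) ys (x∉xs ∷ uxs) xs⊆ys =
    subst (suc (length xs) ≤_) (sym (length-remove ys x∈ys))
      (s≤s (unique-⊆⇒length≤ xs (remove ys x∈ys) uxs xs⊆ys-x))
    where
    x∈ys : x ∈ ys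
    x∈ys = xs⊆ys (here refl)
    xs⊆ys-x : ∀ {z} → z ∈ xs → z ∈ remove ys x∈ys
    xs⊆ys-x z∈xs = ∈-remove ys x∈ys (xs⊆ys (there z∈xs))
                     (λ z≡x → All.lookup x∉xs z∈xs (sym z≡x))

  sublists : List A → List (List A)
  sublists []       = [] ∷ []
  sublists (x ∷ xs) = map (x ∷_) (sublists xs) ++ sublists xs

  filter∈sublists : ∀ {P : Pred A 0ℓ} (P? : Decidable P) xs → filter P? xs ∈ sublists xs
  filter∈sublists P? []       = here refl
  filter∈sublists P? (x ∷ xs) with P? x
  ... | yes _ = ∈-++⁺ˡ (∈-map⁺ (x ∷_) (filter∈sublists P? xs))
  ... | no  _ = ∈-++⁺ʳ (map (x ∷_) (sublists xs)) (filter∈sublists P? xs)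

  shortest : {P : Pred (List A) 0ℓ} → Decidable P → (cs : List (List A)) →
             ∀ {c₀} → P c₀ →
             (∀ S → P S → ∃[ c ] (c ∈ cs × P c × length c ≤ length S)) →
             ∃[ m ] (P m × (∀ S → P S → length m ≤ length S))
  shortest {P} P? cs {c₀} Pc₀ candidate =
    m , argmin-all length Pc₀ (all-filter P? cs) , m-least
    where
    m : List A
    m = argmin length c₀ (filter P? cs)
    m-least : ∀ S → P S → length m ≤ length S
    m-least S PS with candidate S PS
    ... | c , c∈cs , Pc , c≤S =
      ≤-trans (All.lookup (f[argmin]≤f[xs] c₀ (filter P? cs)) (∈-filter⁺ P? c∈cs Pc)) c≤S

module _ {n : ℕ} (G : SimpleGraph n) where

  Covering : List (Edge G) → Set
  Covering L = ∀ x → ∃[ e ] (e ∈ L × x isEndOf e)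

  edge-≡ : ∀ {e f : Edge G} → u e ≡ u f → v e ≡ v f → e ≡ f
  edge-≡ {edge a b p q} {edge .a .b p′ q′} refl refl =
    cong₂ (edge a b) (Fin.<-irrelevant p p′) (T-irrelevant q q′)

  _≟E_ : DecidableEquality (Edge G)
  e ≟E f with u e Fin.≟ u f | v e Fin.≟ v f
  ... | yes a | yes b = yes (edge-≡ a b)
  ... | no  a | _     = no (λ e≡f → a (cong u e≡f))
  ... | _     | no b  = no (λ e≡f → b (cong v e≡f))

  open DecMembership _≟E_ using (_∈?_)

  isEndOf? : (x : Fin n) (e : Edge G) → Dec (x isEndOf e)
  isEndOf? x e = (x Fin.≟ u e) ⊎-dec (x Fin.≟ v e)

  isEdgeCover? : Decidable (IsEdgeCover G)
  isEdgeCover? S = unique? _≟E_ S ×-dec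
    Fin.all? (λ x → map′ find (λ (e , e∈S , x∈e) → lose e∈S x∈e) (Any.any? (isEndOf? x) S))

  edgeBetween : Fin n → Fin n → List (Edge G)
  edgeBetween a b with a Fin.<? b | T? (adj G a b)
  ... | yes a<b | yes ab = edge a b a<b ab ∷ []
  ... | _       | _      = []

  ∈-edgeBetween : (e : Edge G) → e ∈ edgeBetween (u e) (v e)
  ∈-edgeBetween (edge a b a<b ab) with a Fin.<? b | T? (adj G a b)
  ... | yes _    | yes _  = here (edge-≡ refl refl)
  ... | no  a≮b  | _      = ⊥-elim (a≮b a<b)
  ... | yes _    | no ¬ab = ⊥-elim (¬ab ab)

  scanPairs : List (Edge G)
  scanPairs = concatMap (λ a → concatMap (edgeBetween a) (allFin n)) (allFin n)

  edges : List (Edge G)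
  edges = deduplicate _≟E_ scanPairs

  edges-unique : Unique edges
  edges-unique = deduplicate-! _≟E_ scanPairs

  ∈-edges : ∀ e → e ∈ edges
  ∈-edges e = ∈-deduplicate⁺ _≟E_
    (∈-concatMap⁺ _ (lose (∈-allFin (u e)) (∈-concatMap⁺ _ (lose (∈-allFin (v e)) (∈-edgeBetween e)))))

  trim : ∀ L → Covering L →
         ∃[ C ] (C ∈ sublists edges × IsEdgeCover G C × length C ≤ length L)
  trim L L-covers =
    C , filter∈sublists (_∈? L) edges , (C-unique , C-covers) ,
    unique-⊆⇒length≤ C L C-unique (λ e∈C → proj₂ (∈-filter⁻ (_∈? L) {xs = edges} e∈C))
    where
    C : List (Edge G)
    C = filter (_∈? L) edges
    C-unique : Unique C
    C-unique = Unique.filter⁺ (_∈? L) edges-unique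
    C-covers : Covering C
    C-covers x with L-covers x
    ... | e , e∈L , x∈e = e , ∈-filter⁺ (_∈? L) (∈-edges e) e∈L , x∈e

  incidentEdge : NoIsolatedVertex G → (x : Fin n) → Σ (Edge G) (x isEndOf_)
  incidentEdge noIso x with Fin.any? (λ y → T? (adj G x y))
  ... | no  none = ⊥-elim (noIso x (λ y xy → none (y , xy)))
  ... | yes (y , xy) with Fin.<-cmp x y
  ...   | tri< x<y _ _ = edge x y x<y xy , inj₁ refl
  ...   | tri≈ _ x≡y _ = ⊥-elim (loopless G x (subst (λ z → T (adj G x z)) (sym x≡y) xy))
  ...   | tri> _ _ y<x = edge y x y<x (subst T (symmetric G x y) xy) , inj₂ refl

  minimumEdgeCover : NoIsolatedVertex G →
    ∃[ C ] (IsEdgeCover G C × (∀ S → IsEdgeCover G S → length C ≤ length S))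
  minimumEdgeCover noIso =
    shortest isEdgeCover? (sublists edges) edges-cover (λ S (_ , S-covers) → trim S S-covers)
    where
    edges-cover : IsEdgeCover G edges
    edges-cover = edges-unique ,
      λ x → let (e , x∈e) = incidentEdge noIso x in e , ∈-edges e , x∈e

  cover⇒dominating : ∀ {C} → IsEdgeCover G C → IsDominatingSetM G (map inj₂ C)
  cover⇒dominating {C} (C-unique , C-covers) =
    Unique.map⁺ inj₂-injective C-unique , dominated
    where
    inj₂-injective : ∀ {e f : Edge G} → _≡_ {A = MVertex G} (inj₂ e) (inj₂ f) → e ≡ f
    inj₂-injective refl = refl
    dominated : ∀ x → (x ∈ map inj₂ C) ⊎ (∃[ y ] (y ∈ map inj₂ C × MAdj x y))
    dominated (inj₁ x) with C-covers x
    ... | e , e∈C , x∈e = inj₂ (inj₂ e , ∈-map⁺ inj₂ e∈C , vert-edge x e x∈e)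
    dominated (inj₂ e) with e ∈? C
    ... | yes e∈C = inj₁ (∈-map⁺ inj₂ e∈C)
    ... | no  e∉C with C-covers (u e)
    ...   | f , f∈C , ue∈f = inj₂ (inj₂ f , ∈-map⁺ inj₂ f∈C ,
              edge-edge e f (λ e≡f → e∉C (subst (_∈ C) (sym e≡f) f∈C)) (u e) (inj₁ refl) ue∈f)

  dominating⇒cover : NoIsolatedVertex G → ∀ D → IsDominatingSetM G D →
                     ∃[ C ] (IsEdgeCover G C × length C ≤ length D)
  dominating⇒cover noIso D (_ , D-dominates) =
    let (C , _ , C-cover , C≤) = trim (map toEdge D) covering
    in C , C-cover , subst (length C ≤_) (length-map toEdge D) C≤
    where
    toEdge : MVertex G → Edge G
    toEdge (inj₁ x) = proj₁ (incidentEdge noIso x)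
    toEdge (inj₂ e) = e
    covering : Covering (map toEdge D)
    covering x with D-dominates (inj₁ x)
    ... | inj₁ x∈D = let (e , x∈e) = incidentEdge noIso x in e , ∈-map⁺ toEdge x∈D , x∈e
    ... | inj₂ (.(inj₂ e) , e∈D , vert-edge .x e x∈e) = e , ∈-map⁺ toEdge e∈D , x∈e

theorem2p10 : (n : ℕ) → 2 ≤ n → (G : SimpleGraph n) → NoIsolatedVertex G →
    ∃[ k ] (IsDominationNumberM G k × IsEdgeCoverNumber G k)
theorem2p10 n _ G noIso with minimumEdgeCover G noIso
... | C , C-cover , C-least =
  length C ,
  ((map inj₂ C , cover⇒dominating G C-cover , length-map inj₂ C) , γ-lower-bound) ,
  ((C , C-cover , refl) , C-least)
  where
  γ-lower-bound : ∀ D → IsDominatingSetM G D → length C ≤ length D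
  γ-lower-bound D D-dominates with dominating⇒cover G noIso D D-dominates
  ... | C′ , C′-cover , C′≤D = ≤-trans (C-least C′ C′-cover) C′≤D
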